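{- Let $G$ be a finite Abelian group and let $\eta>0$. Then every $(1-\eta)$-additively connected subset $U$ of $G$ has the $(1-\eta)$-extension property.
   Context: Let $U\subset G$. For $W\subset U$ with $V=U\setminus W$, $W$ is additively isolated in $U$ if $(V+V-V)\cap W=\emptyset$. $U$ is $(1-\eta)$-additively connected if no non-empty subset of $U$ of size at most $\eta|U|$ is additively isolated in $U$. An affine homomorphism on $U$ into an Abelian group $H$ is a function $u\mapsto a+\psi(u)$ with $a\in H$ and $\psi$ the restriction to $U$ of a group homomorphism $G\to H$. A Freiman homomorphism $\phi:U\to H$ satisfies $\phi(a)+\phi(b)=\phi(c)+\phi(d)$ whenever $a,b,c,d\in U$ with $a+b=c+d$. $U$ has the $(1-\eta)$-extension property if, for every Abelian group $H$, every Freiman homomorphism from $U$ to $H$ that coincides with an affine homomorphism $\phi$ on a subset $V\subset U$ of size at least $(1-\eta)|U|$ is equal to $\phi$ on all of $U$.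
   Formalization: The parameter η ranges over the positive rationals. -}

module Defs where

open import Level using (Level; 0ℓ) renaming (suc to lsuc; _⊔_ to _⊔ˡ_)
open import Data.Nat using (ℕ; _*_; _≤_; _∸_; NonZero)
open import Data.Fin using (Fin)
open import Data.Fin.Subset using (Subset; _∈_; _∉_; _⊆_; ∣_∣; Nonempty)
open import Data.Product using (_×_)
open import Relation.Binary.PropositionalEquality using (_≡_)
open import Relation.Nullary using (¬_)
open import Algebra.Bundles using (AbelianGroup; RawGroup)
open import Algebra.Structures using (IsAbelianGroup)
open import Algebra.Morphism.Structures using (module GroupMorphisms)

-- A finite Abelian group of order n, presented (up to isomorphism) as an
-- Abelian group structure on Fin n with propositional equality.
record FinAbGroup (n : ℕ) : Set where
  infixl 6 _+_ _-_
  field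
    _+_ : Fin n → Fin n → Fin n
    0#  : Fin n
    -_  : Fin n → Fin n
    isAbelianGroup : IsAbelianGroup _≡_ _+_ 0# -_

  _-_ : Fin n → Fin n → Fin n
  x - y = x + (- y)

  rawGroup : RawGroup 0ℓ 0ℓ
  rawGroup = record { _≈_ = _≡_ ; _∙_ = _+_ ; ε = 0# ; _⁻¹ = -_ }

module _ {n : ℕ} (G : FinAbGroup n) where
  open FinAbGroup G

  AdditivelyIsolated : Subset n → Subset n → Set
  AdditivelyIsolated U W =
    W ⊆ U ×
    (∀ a b c w → a ∈ U → a ∉ W → b ∈ U → b ∉ W → c ∈ U → c ∉ W → w ∈ W →
       ¬ (a + b - c ≡ w))

  -- U is (1 - η)-additively connected, with η = p / q:
  -- no non-empty W ⊆ U with |W| ≤ η |U| is additively isolated in U.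
  AdditivelyConnected : (p q : ℕ) → Subset n → Set
  AdditivelyConnected p q U =
    ∀ W → W ⊆ U → Nonempty W → q * ∣ W ∣ ≤ p * ∣ U ∣ → ¬ AdditivelyIsolated U W

  module _ {c ℓ : Level} (H : AbelianGroup c ℓ) where
    private module H = AbelianGroup H

    -- Freiman homomorphism U → H (given as a function on G; only values on U matter).
    IsFreimanHom : Subset n → (Fin n → H.Carrier) → Set ℓ
    IsFreimanHom U φ = ∀ a b c d → a ∈ U → b ∈ U → c ∈ U → d ∈ U →
      a + b ≡ c + d → (φ a H.∙ φ b) H.≈ (φ c H.∙ φ d)

    IsGroupHom : (Fin n → H.Carrier) → Set ℓ
    IsGroupHom ψ = GroupMorphisms.IsGroupHomomorphism rawGroup H.rawGroup ψ

    AgreesOn : Subset n → (Fin n → H.Carrier) → H.Carrier → (Fin n → H.Carrier) → Set ℓ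
    AgreesOn V φ a ψ = ∀ u → u ∈ V → φ u H.≈ (a H.∙ ψ u)

  -- (1 - η)-extension property (η = p / q), for target groups in universe levels c, ℓ.
  -- |V| ≥ (1 - η)|U| is written q |V| ≥ (q ∸ p) |U| (trivial when η ≥ 1).
  ExtensionProperty : (c ℓ : Level) → (p q : ℕ) → Subset n → Set (lsuc (c ⊔ˡ ℓ))
  ExtensionProperty c ℓ p q U =
    (H : AbelianGroup c ℓ) → (φ : Fin n → AbelianGroup.Carrier H) →
    IsFreimanHom H U φ →
    (a : AbelianGroup.Carrier H) → (ψ : Fin n → AbelianGroup.Carrier H) → IsGroupHom H ψ →
    (V : Subset n) → V ⊆ U → (q ∸ p) * ∣ U ∣ ≤ q * ∣ V ∣ →
    AgreesOn H V φ a ψ → AgreesOn H U φ a ψ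

module Submission where

-- Let φ be a Freiman homomorphism on U that agrees with the
-- affine map u ↦ α + ψ(u) on a large subset V ⊆ U.  If a, b, d are points
-- of agreement and w = a + b - d lies in U, then w is a point of agreement
-- too: the Freiman relation φ(a) + φ(b) = φ(d) + φ(w) together with the
-- homomorphism property of ψ forces φ(w) = α + ψ(w).  Starting from V and
-- adjoining such points one at a time yields (constructively, as agreement
-- in H is not decidable) a set T with V ⊆ T ⊆ U of agreement points which is
-- closed under this rule.  Closure says precisely that W = U \ T is
-- additively isolated in U, and W ⊆ U \ V is small.  Additive connectivity
-- therefore forces W = ∅, i.e. φ agrees with the affine map on all of U.

open import Defs
open import Level using (Level; 0ℓ)
open import Data.Nat using (ℕ; NonZero; suc; zero; _+_; _*_; _∸_; _≤_; _<_; s≤s)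
import Data.Nat.Properties as ℕ
open import Data.Fin using (Fin)
open import Data.Fin.Subset using (Subset; _∈_; _∉_; _⊆_; ∣_∣; _∪_; _─_; ⁅_⁆; inside; outside)
open import Data.Fin.Subset.Properties
  using ( _∈?_; drop-∷-⊆; p⊆q⇒∣p∣≤∣q∣; p⊂q⇒∣p∣<∣q∣; ∣p∣≤n; p⊆p∪q; q⊆p∪q; x∈p∪q⁻
        ; x∈⁅x⁆; x∈⁅y⁆⇒x≡y; p─q⊆p; x∈p∧x∉q⇒x∈p─q)
open import Data.Fin.Properties using (any?; _≟_)
open import Data.Vec using (_∷_; []; here; there)
open import Data.Product using (Σ; ∃; _×_; _,_; proj₂)
open import Data.Sum using (inj₁; inj₂)
open import Relation.Binary.PropositionalEquality using (_≡_; refl; sym; trans; cong; subst; module ≡-Reasoning)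
open import Relation.Nullary using (¬_; Dec; yes; no; contradiction)
open import Relation.Nullary.Decidable using (_×-dec_; ¬?)
open import Algebra.Bundles using (AbelianGroup)
import Algebra.Properties.Group as GroupProperties
import Algebra.Properties.CommutativeSemigroup as CommutativeSemigroupProperties
open import Algebra.Morphism.Structures using (module GroupMorphisms)

x∈p─q⇒x∉q : ∀ {n} (p q : Subset n) {x : Fin n} → x ∈ p ─ q → x ∉ q
x∈p─q⇒x∉q (_ ∷ p) (outside ∷ q) here       ()
x∈p─q⇒x∉q (_ ∷ p) (_ ∷ q)       (there x∈) (there x∈q) = x∈p─q⇒x∉q p q x∈ x∈q

─-antimonoʳ : ∀ {n} (p : Subset n) {q r : Subset n} → q ⊆ r → p ─ r ⊆ p ─ q
─-antimonoʳ p {q} {r} q⊆r x∈ = x∈p∧x∉q⇒x∈p─q (p─q⊆p p r x∈) (λ x∈q → x∈p─q⇒x∉q p r x∈ (q⊆r x∈q))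

∣p─q∣+∣q∣≡∣p∣ : ∀ {n} (p q : Subset n) → q ⊆ p → ∣ p ─ q ∣ + ∣ q ∣ ≡ ∣ p ∣
∣p─q∣+∣q∣≡∣p∣ []            []            _   = refl
∣p─q∣+∣q∣≡∣p∣ (outside ∷ p) (outside ∷ q) q⊆p = ∣p─q∣+∣q∣≡∣p∣ p q (drop-∷-⊆ q⊆p)
∣p─q∣+∣q∣≡∣p∣ (inside ∷ p)  (outside ∷ q) q⊆p = cong suc (∣p─q∣+∣q∣≡∣p∣ p q (drop-∷-⊆ q⊆p))
∣p─q∣+∣q∣≡∣p∣ (inside ∷ p)  (inside ∷ q)  q⊆p =
  trans (ℕ.+-suc ∣ p ─ q ∣ ∣ q ∣) (cong suc (∣p─q∣+∣q∣≡∣p∣ p q (drop-∷-⊆ q⊆p)))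
∣p─q∣+∣q∣≡∣p∣ (outside ∷ p) (inside ∷ q)  q⊆p with q⊆p here
... | ()

-- If V ⊆ U has q∣V∣ ≥ (q ∸ p)∣U∣ (i.e. |V| ≥ (1 - p/q)|U|), then a set X
-- disjoint from V inside U has q∣X∣ ≤ p∣U∣.  Here x, v, u stand for the sizes.
small-complement : ∀ p q x v u → x + v ≤ u → (q ∸ p) * u ≤ q * v → q * x ≤ p * u
small-complement p q x v u x+v≤u large = ℕ.+-cancelʳ-≤ (q * v) (q * x) (p * u) (begin
  q * x + q * v            ≡⟨ ℕ.*-distribˡ-+ q x v ⟨
  q * (x + v)              ≤⟨ ℕ.*-monoʳ-≤ q x+v≤u ⟩
  q * u                    ≤⟨ ℕ.*-monoˡ-≤ u (ℕ.m≤n+m∸n q p) ⟩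
  (p + (q ∸ p)) * u        ≡⟨ ℕ.*-distribʳ-+ u p (q ∸ p) ⟩
  p * u + (q ∸ p) * u      ≤⟨ ℕ.+-monoʳ-≤ (p * u) large ⟩
  p * u + q * v            ∎)
  where open ℕ.≤-Reasoning

AllIn : ∀ {n ℓ} → (Fin n → Set ℓ) → Subset n → Set ℓ
AllIn P S = ∀ {u} → u ∈ S → P u

-- Termination: each step enlarges the subset, which has at most n points.
module Saturation {n ℓ} {P : Fin n → Set ℓ}
  (Derivable : Subset n → Fin n → Set)
  (derivable? : ∀ S w → Dec (Derivable S w))
  (fresh : ∀ {S w} → Derivable S w → w ∉ S)
  (sound : ∀ {S w} → AllIn P S → Derivable S w → P w) where

  Closure : Subset n → Set ℓ
  Closure S = Σ (Subset n) λ T → S ⊆ T × AllIn P T × (∀ w → ¬ Derivable T w)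

  private
    adjoin : ∀ {S w} → AllIn P S → Derivable S w → AllIn P (S ∪ ⁅ w ⁆)
    adjoin {S} {w} all d u∈ with x∈p∪q⁻ S ⁅ w ⁆ u∈
    ... | inj₁ u∈S = all u∈S
    ... | inj₂ u∈w = subst P (sym (x∈⁅y⁆⇒x≡y w u∈w)) (sound all d)

    grows : ∀ {S w} → Derivable S w → ∣ S ∣ < ∣ S ∪ ⁅ w ⁆ ∣
    grows {S} {w} d = p⊂q⇒∣p∣<∣q∣ (p⊆p∪q ⁅ w ⁆ , w , q⊆p∪q S ⁅ w ⁆ (x∈⁅x⁆ w) , fresh d)

    -- Saturation with k remaining steps; the bound makes k = 0 impossible.
    saturate-within : ∀ k S → n < k + ∣ S ∣ → AllIn P S → Closure S
    saturate-within zero    S bound all = contradiction (∣p∣≤n S) (ℕ.<⇒≱ bound)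
    saturate-within (suc k) S bound all with any? (derivable? S)
    ... | no none = S , (λ u∈ → u∈) , all , λ w d → none (w , d)
    ... | yes (w , d) with saturate-within k (S ∪ ⁅ w ⁆) bound′ (adjoin all d)
      where
      bound′ : n < k + ∣ S ∪ ⁅ w ⁆ ∣
      bound′ = ℕ.<-≤-trans bound (subst (_≤ k + ∣ S ∪ ⁅ w ⁆ ∣)
                 (ℕ.+-suc k ∣ S ∣) (ℕ.+-monoʳ-≤ k (grows d)))
    ...   | T , S∪w⊆T , allT , closed = T , (λ u∈ → S∪w⊆T (p⊆p∪q ⁅ w ⁆ u∈)) , allT , closed

  saturate : ∀ S → AllIn P S → Closure S
  saturate S = saturate-within (suc n) S (s≤s (ℕ.m≤m+n n ∣ S ∣))

module _ {n : ℕ} (G : FinAbGroup n) where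
  open FinAbGroup G using (isAbelianGroup) renaming (_+_ to _⊕_; _-_ to _⊖_)

  private
    groupG : AbelianGroup 0ℓ 0ℓ
    groupG = record { isAbelianGroup = isAbelianGroup }

  sum-of-difference : ∀ {a b d w} → a ⊕ b ⊖ d ≡ w → a ⊕ b ≡ d ⊕ w
  sum-of-difference {a} {b} {d} {w} e = begin
    a ⊕ b              ≡⟨ //-rightDividesˡ d (a ⊕ b) ⟨
    (a ⊕ b ⊖ d) ⊕ d    ≡⟨ cong (_⊕ d) e ⟩
    w ⊕ d              ≡⟨ AbelianGroup.comm groupG w d ⟩
    d ⊕ w              ∎
    where open ≡-Reasoning
          open GroupProperties (AbelianGroup.group groupG) using (//-rightDividesˡ)

  FreshSumDiff : Subset n → Subset n → Fin n → Set
  FreshSumDiff U S w = w ∈ U × w ∉ S ×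
    ∃ λ a → ∃ λ b → ∃ λ d → a ∈ S × b ∈ S × d ∈ S × (a ⊕ b ⊖ d ≡ w)

  freshSumDiff? : ∀ U S w → Dec (FreshSumDiff U S w)
  freshSumDiff? U S w = (w ∈? U) ×-dec ¬? (w ∈? S) ×-dec
    any? λ a → any? λ b → any? λ d →
      (a ∈? S) ×-dec (b ∈? S) ×-dec (d ∈? S) ×-dec (a ⊕ b ⊖ d ≟ w)

  closed⇒isolated : ∀ U T → (∀ w → ¬ FreshSumDiff U T w) → AdditivelyIsolated G U (U ─ T)
  closed⇒isolated U T closed = p─q⊆p U T ,
    λ a b d w a∈U a∉W b∈U b∉W d∈U d∉W w∈W e →
      closed w ( p─q⊆p U T w∈W , x∈p─q⇒x∉q U T w∈W
               , a , b , d , inT a∈U a∉W , inT b∈U b∉W , inT d∈U d∉W , e)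
    where
    inT : ∀ {x} → x ∈ U → x ∉ U ─ T → x ∈ T
    inT {x} x∈U x∉W with x ∈? T
    ... | yes x∈T = x∈T
    ... | no  x∉T = contradiction (x∈p∧x∉q⇒x∈p─q x∈U x∉T) x∉W

  module _ {c ℓ : Level} (H : AbelianGroup c ℓ) (U : Subset n)
    {φ : Fin n → AbelianGroup.Carrier H} (freiman : IsFreimanHom G H U φ)
    (α : AbelianGroup.Carrier H) {ψ : Fin n → AbelianGroup.Carrier H} (hom : IsGroupHom G H ψ) where
    open AbelianGroup H using (_≈_; _∙_; setoid; ∙-cong; ∙-congˡ; ∙-congʳ; reflexive)
      renaming (sym to ≈-sym)
    open GroupMorphisms.IsGroupHomomorphism hom using (homo)
    open GroupProperties (AbelianGroup.group H) using (∙-cancelˡ)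
    open CommutativeSemigroupProperties (AbelianGroup.commutativeSemigroup H) using (interchange)

    Agrees : Fin n → Set ℓ
    Agrees u = u ∈ U × φ u ≈ α ∙ ψ u

    propagate : ∀ {a b d w} → Agrees a → Agrees b → Agrees d → w ∈ U →
      a ⊕ b ≡ d ⊕ w → Agrees w
    propagate {a} {b} {d} {w} (a∈U , φa) (b∈U , φb) (d∈U , φd) w∈U quad =
      w∈U , ∙-cancelˡ (α ∙ ψ d) (φ w) (α ∙ ψ w) (begin
        (α ∙ ψ d) ∙ φ w          ≈⟨ ∙-congʳ (≈-sym φd) ⟩
        φ d ∙ φ w                ≈⟨ freiman a b d w a∈U b∈U d∈U w∈U quad ⟨
        φ a ∙ φ b                ≈⟨ ∙-cong φa φb ⟩
        (α ∙ ψ a) ∙ (α ∙ ψ b)    ≈⟨ interchange α (ψ a) α (ψ b) ⟩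
        (α ∙ α) ∙ (ψ a ∙ ψ b)    ≈⟨ ∙-congˡ (homo a b) ⟨
        (α ∙ α) ∙ ψ (a ⊕ b)      ≈⟨ ∙-congˡ (reflexive (cong ψ quad)) ⟩
        (α ∙ α) ∙ ψ (d ⊕ w)      ≈⟨ ∙-congˡ (homo d w) ⟩
        (α ∙ α) ∙ (ψ d ∙ ψ w)    ≈⟨ interchange α (ψ d) α (ψ w) ⟨
        (α ∙ ψ d) ∙ (α ∙ ψ w)    ∎)
      where open import Relation.Binary.Reasoning.Setoid setoid

    closed-agreement-set : ∀ S → AllIn Agrees S →
      Σ (Subset n) λ T → S ⊆ T × AllIn Agrees T × (∀ w → ¬ FreshSumDiff U T w)
    closed-agreement-set = saturate
      where
      open Saturation (FreshSumDiff U) (freshSumDiff? U) (λ (_ , w∉S , _) → w∉S)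
        (λ all (w∈U , _ , a , b , d , a∈ , b∈ , d∈ , e) →
          propagate (all a∈) (all b∈) (all d∈) w∈U (sum-of-difference e))

lemma7p3 : (c ℓ : Level) (n : ℕ) (G : FinAbGroup n) (p q : ℕ) → .{{NonZero p}} → .{{NonZero q}} →
    (U : Subset n) → AdditivelyConnected G p q U → ExtensionProperty G c ℓ p q U
lemma7p3 c ℓ n G p q U connected H φ freiman α ψ hom V V⊆U large agreeV u u∈U
  with closed-agreement-set G H U freiman α hom V (λ v∈ → V⊆U v∈ , agreeV _ v∈)
... | T , V⊆T , agreeT , closed with u ∈? T
...   | yes u∈T = proj₂ (agreeT u∈T)
...   | no  u∉T = contradiction (closed⇒isolated G U T closed)
                    (connected (U ─ T) (p─q⊆p U T) (u , x∈p∧x∉q⇒x∈p─q u∈U u∉T) W-small)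
  where
  -- U ─ T ⊆ U ─ V, and U ─ V is small because V is large.
  W-small : q * ∣ U ─ T ∣ ≤ p * ∣ U ∣
  W-small = ℕ.≤-trans (ℕ.*-monoʳ-≤ q (p⊆q⇒∣p∣≤∣q∣ (─-antimonoʳ U V⊆T)))
    (small-complement p q (∣ U ─ V ∣) (∣ V ∣) (∣ U ∣) (ℕ.≤-reflexive (∣p─q∣+∣q∣≡∣p∣ U V V⊆U)) large)
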